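{- For every integer $c\geq 3$, there exists a graph $G$ with $\operatorname{diam}(G)=2$ such that $L_{2,t}(G)=c$.
   Context: All graphs are finite and simple; $\operatorname{diam}(G)$ is the diameter. $N(v)$ denotes the open neighborhood of $v$. A set $B\subseteq V(G)$ is a $2$-total limited packing set if $|B\cap N(v)|\leq 2$ for every $v\in V(G)$; $L_{2,t}(G)$ is the maximum cardinality of such a set. -}

module Defs where

open import Data.Nat using (ℕ; zero; suc; _≤_)
open import Data.Fin using (Fin)
open import Data.Fin.Subset using (Subset; _∈_; ∣_∣; _∩_)
open import Data.Bool using (Bool; true; false)
open import Data.Product using (Σ; _×_; ∃; ∃-syntax; _,_)
open import Relation.Binary.PropositionalEquality using (_≡_)
open import Relation.Nullary using (¬_)
open import Data.Vec using (tabulate)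

record Graph (n : ℕ) : Set where
  field
    adj   : Fin n → Fin n → Bool
    sym   : ∀ u v → adj u v ≡ adj v u
    irrefl : ∀ v → adj v v ≡ false

open Graph public

Adj : ∀ {n} → Graph n → Fin n → Fin n → Set
Adj G u v = adj G u v ≡ true

data Walk {n : ℕ} (G : Graph n) : ℕ → Fin n → Fin n → Set where
  here : ∀ {v} → Walk G zero v v
  step : ∀ {k u w v} → Adj G u w → Walk G k w v → Walk G (suc k) u v

DistLe : ∀ {n} → Graph n → ℕ → Fin n → Fin n → Set
DistLe G k u v = ∃[ j ] (j ≤ k × Walk G j u v)

DiamEq : ∀ {n} → Graph n → ℕ → Set
DiamEq {n} G zero = (∀ u v → DistLe G zero u v) × Fin n
DiamEq G (suc d) = (∀ u v → DistLe G (suc d) u v)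
                 × ∃[ u ] ∃[ v ] ¬ DistLe G d u v

N : ∀ {n} → Graph n → Fin n → Subset n
N G v = tabulate (adj G v)

Is2TLP : ∀ {n} → Graph n → Subset n → Set
Is2TLP G B = ∀ v → ∣ B ∩ N G v ∣ ≤ 2

L2tEq : ∀ {n} → Graph n → ℕ → Set
L2tEq G c = (∃[ B ] (Is2TLP G B × ∣ B ∣ ≡ c))
          × (∀ B → Is2TLP G B → ∣ B ∣ ≤ c)

{-# OPTIONS --safe #-}

-- For c = 3 the path P₃ works.  For c = 4 + m take c independent leaves, two adjacent hubs
-- attached to leaves 0, 1 and to leaves 2, 3 respectively, and a clique of bridges, one for
-- each pair (a, b) of leaves, adjacent to leaves a, b and to both hubs.  The bridges give
-- diameter two, and no vertex sees more than two leaves, so the leaves form a 2-total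
-- limited packing of size c.  Conversely every vertex is a neighbour of a hub or one of the
-- m leaves 4, …, c − 1, so a 2-total limited packing has at most 2 + 2 + m = c vertices.

module Submission where

open import Defs
open import Data.Nat using (ℕ; _≤_)
open import Data.Product using (Σ; _×_; ∃; ∃-syntax)

open import Data.Bool using (Bool; true; false; not; _∧_; _∨_; _xor_)
open import Data.Bool.Properties using (∨-zeroʳ; xor-comm; xor-same)
open import Data.Empty using (⊥-elim)
open import Data.Fin using (Fin; zero; suc; _↑ˡ_; combine; remQuot; _≟_)
open import Data.Fin.Patterns using (0F; 1F; 2F; 3F)
open import Data.Fin.Properties using (+↔⊎; remQuot-combine; combine-remQuot)
open import Data.Fin.Subset using (Subset; _∈_; ∣_∣; _∩_; _∪_; ⁅_⁆; ⊤; ⊥; _⊆_)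
open import Data.Fin.Subset.Properties
  using (p⊆q⇒∣p∣≤∣q∣; ∣⁅x⁆∣≡1; x∈⁅y⁆⇔x≡y; ∣⊥∣≡0; ∉⊥; ∣p∣≤n; x∈p∩q⁺; x∈p∩q⁻; x∈p∪q⁺)
open import Data.Nat using (zero; suc; _+_; _*_; z≤n; s≤s)
open import Data.Nat.Properties using (≤-refl; ≤-trans; ≤-reflexive; n≤1+n; +-suc; +-monoʳ-≤; +-mono-≤; module ≤-Reasoning)
open import Data.Product using (_,_; ∃₂; uncurry)
import Data.Product as Product
open import Data.Sum using (_⊎_; inj₁; inj₂)
import Data.Sum as Sum
open import Data.Vec using (_∷_; []; _++_; here; there)
open import Data.Vec.Properties using ([]=⇒lookup; lookup⇒[]=; lookup∘tabulate)
open import Function using (_∘_)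
open import Function.Bundles using (_↔_; Inverse; Equivalence; mk↔ₛ′; mk⇔)
open import Function.Construct.Composition using (_↔-∘_)
open import Function.Construct.Symmetry using (↔-sym)
open import Relation.Binary.PropositionalEquality using (_≡_; _≢_; refl; trans; cong; cong₂; subst)
import Relation.Binary.PropositionalEquality as ≡
open import Relation.Nullary using (¬_; does; yes; no)
open import Relation.Nullary.Decidable using (dec-true; does-⇔)

∣p∪q∣≤∣p∣+∣q∣ : ∀ {n} (p q : Subset n) → ∣ p ∪ q ∣ ≤ ∣ p ∣ + ∣ q ∣
∣p∪q∣≤∣p∣+∣q∣ []          []          = z≤n
∣p∪q∣≤∣p∣+∣q∣ (true ∷ p)  (true ∷ q)  =
  s≤s (≤-trans (∣p∪q∣≤∣p∣+∣q∣ p q) (+-monoʳ-≤ ∣ p ∣ (n≤1+n ∣ q ∣)))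
∣p∪q∣≤∣p∣+∣q∣ (true ∷ p)  (false ∷ q) = s≤s (∣p∪q∣≤∣p∣+∣q∣ p q)
∣p∪q∣≤∣p∣+∣q∣ (false ∷ p) (true ∷ q)  =
  ≤-trans (s≤s (∣p∪q∣≤∣p∣+∣q∣ p q)) (≤-reflexive (≡.sym (+-suc ∣ p ∣ ∣ q ∣)))
∣p∪q∣≤∣p∣+∣q∣ (false ∷ p) (false ∷ q) = ∣p∪q∣≤∣p∣+∣q∣ p q

∣p∣≤2 : ∀ {n} {p : Subset n} {a b : Fin n} → (∀ {x} → x ∈ p → x ≡ a ⊎ x ≡ b) → ∣ p ∣ ≤ 2
∣p∣≤2 {p = p} {a} {b} p⊆ab = begin
  ∣ p ∣                 ≤⟨ p⊆q⇒∣p∣≤∣q∣ (x∈p∪q⁺ ∘ Sum.map in⁅⁆ in⁅⁆ ∘ p⊆ab) ⟩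
  ∣ ⁅ a ⁆ ∪ ⁅ b ⁆ ∣     ≤⟨ ∣p∪q∣≤∣p∣+∣q∣ ⁅ a ⁆ ⁅ b ⁆ ⟩
  ∣ ⁅ a ⁆ ∣ + ∣ ⁅ b ⁆ ∣ ≡⟨ cong₂ _+_ (∣⁅x⁆∣≡1 a) (∣⁅x⁆∣≡1 b) ⟩
  2                     ∎
  where
  open ≤-Reasoning
  in⁅⁆ : ∀ {n} {x y : Fin n} → x ≡ y → x ∈ ⁅ y ⁆
  in⁅⁆ = Equivalence.from x∈⁅y⁆⇔x≡y

∣⊤++⊥∣≡m : ∀ m r → ∣ ⊤ {m} ++ ⊥ {r} ∣ ≡ m
∣⊤++⊥∣≡m zero    r = ∣⊥∣≡0 r
∣⊤++⊥∣≡m (suc m) r = cong suc (∣⊤++⊥∣≡m m r)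

↑ˡ∈⊤++⊥ : ∀ {m r} (i : Fin m) → i ↑ˡ r ∈ ⊤ {m} ++ ⊥ {r}
↑ˡ∈⊤++⊥ zero    = here
↑ˡ∈⊤++⊥ (suc i) = there (↑ˡ∈⊤++⊥ i)

∈⊤++⊥⇒↑ˡ : ∀ {m r} {x : Fin (m + r)} → x ∈ ⊤ {m} ++ ⊥ {r} → ∃[ i ] x ≡ i ↑ˡ r
∈⊤++⊥⇒↑ˡ {zero}  x∈⊥         = ⊥-elim (∉⊥ x∈⊥)
∈⊤++⊥⇒↑ˡ {suc m} here        = zero , refl
∈⊤++⊥⇒↑ˡ {suc m} (there x∈p) = Product.map suc (cong suc) (∈⊤++⊥⇒↑ˡ x∈p)

_≡ᵇ_ : ∀ {k} → Fin k → Fin k → Bool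
i ≡ᵇ j = does (i ≟ j)

≡ᵇ-refl : ∀ {k} (i : Fin k) → i ≡ᵇ i ≡ true
≡ᵇ-refl i = dec-true (i ≟ i) refl

≡ᵇ-sym : ∀ {k} (i j : Fin k) → i ≡ᵇ j ≡ j ≡ᵇ i
≡ᵇ-sym i j = does-⇔ (mk⇔ ≡.sym ≡.sym) (i ≟ j) (j ≟ i)

Within2 : {A : Set} → (A → A → Set) → A → A → Set
Within2 _~_ x y = x ~ y ⊎ ∃[ w ] (x ~ w × w ~ y)

Within2-sym : ∀ {A : Set} {_~_ : A → A → Set} → (∀ x y → x ~ y → y ~ x) →
              ∀ {x y} → Within2 _~_ x y → Within2 _~_ y x
Within2-sym ~-sym {x} {y} (inj₁ x~y)           = inj₁ (~-sym x y x~y)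
Within2-sym ~-sym {x} {y} (inj₂ (w , x~w , w~y)) = inj₂ (w , ~-sym w y w~y , ~-sym x w x~w)

module _ {n : ℕ} (G : Graph n) where

  ∈N⇒Adj : ∀ {u x} → x ∈ N G u → Adj G u x
  ∈N⇒Adj {u} {x} x∈N = trans (≡.sym (lookup∘tabulate (adj G u) x)) ([]=⇒lookup x∈N)

  Adj⇒∈N : ∀ {u x} → Adj G u x → x ∈ N G u
  Adj⇒∈N {u} {x} u~x = lookup⇒[]= x (N G u) (trans (lookup∘tabulate (adj G u) x) u~x)

  Within2⇒DistLe2 : ∀ {u v} → Within2 (Adj G) u v → DistLe G 2 u v
  Within2⇒DistLe2 (inj₁ u~v)           = 1 , s≤s z≤n , step u~v here
  Within2⇒DistLe2 (inj₂ (w , u~w , w~v)) = 2 , ≤-refl , step u~w (step w~v here)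

  ¬DistLe1 : ∀ {u v} → u ≢ v → ¬ Adj G u v → ¬ DistLe G 1 u v
  ¬DistLe1 u≢v ¬u~v (0 , _ , here)             = u≢v refl
  ¬DistLe1 u≢v ¬u~v (1 , _ , step u~v here)    = ¬u~v u~v
  ¬DistLe1 u≢v ¬u~v (suc (suc _) , s≤s () , _)

  diam≡2 : (∀ u v → Within2 (Adj G) u v) → ∀ {u v} → u ≢ v → ¬ Adj G u v → DiamEq G 2
  diam≡2 within2 u≢v ¬u~v = (λ u v → Within2⇒DistLe2 (within2 u v)) , _ , _ , ¬DistLe1 u≢v ¬u~v

  Is2TLP⇒∣B∣≤2+2+∣R∣ : ∀ {u v} {R : Subset n} → (∀ x → x ∈ N G u ⊎ x ∈ N G v ⊎ x ∈ R) →
                       ∀ B → Is2TLP G B → ∣ B ∣ ≤ 2 + 2 + ∣ R ∣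
  Is2TLP⇒∣B∣≤2+2+∣R∣ {u} {v} {R} cover B packing = begin
    ∣ B ∣                                   ≤⟨ p⊆q⇒∣p∣≤∣q∣ B⊆ ⟩
    ∣ B ∩ N G u ∪ (B ∩ N G v ∪ R) ∣         ≤⟨ ∣p∪q∣≤∣p∣+∣q∣ (B ∩ N G u) _ ⟩
    ∣ B ∩ N G u ∣ + ∣ B ∩ N G v ∪ R ∣       ≤⟨ +-mono-≤ (packing u) (∣p∪q∣≤∣p∣+∣q∣ (B ∩ N G v) R) ⟩
    2 + (∣ B ∩ N G v ∣ + ∣ R ∣)             ≤⟨ +-monoʳ-≤ 2 (+-mono-≤ (packing v) ≤-refl) ⟩
    2 + 2 + ∣ R ∣                           ∎
    where
    open ≤-Reasoning
    B⊆ : B ⊆ B ∩ N G u ∪ (B ∩ N G v ∪ R)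
    B⊆ {x} x∈B with cover x
    ... | inj₁ x∈Nu        = x∈p∪q⁺ (inj₁ (x∈p∩q⁺ (x∈B , x∈Nu)))
    ... | inj₂ (inj₁ x∈Nv) = x∈p∪q⁺ (inj₂ (x∈p∪q⁺ (inj₁ (x∈p∩q⁺ (x∈B , x∈Nv)))))
    ... | inj₂ (inj₂ x∈R)  = x∈p∪q⁺ (inj₂ (x∈p∪q⁺ (inj₂ x∈R)))

module FromRelation {V : Set} {n : ℕ} (V↔Fin : V ↔ Fin n) (_~ᵇ_ : V → V → Bool)
                    (~ᵇ-sym : ∀ x y → x ~ᵇ y ≡ y ~ᵇ x) (~ᵇ-irrefl : ∀ x → x ~ᵇ x ≡ false) where

  open Inverse V↔Fin public using (to; from; strictlyInverseˡ; strictlyInverseʳ)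

  graph : Graph n
  graph = record
    { adj    = λ u v → from u ~ᵇ from v
    ; sym    = λ u v → ~ᵇ-sym (from u) (from v)
    ; irrefl = λ v → ~ᵇ-irrefl (from v)
    }

  _~_ : V → V → Set
  x ~ y = x ~ᵇ y ≡ true

  ~-sym : ∀ x y → x ~ y → y ~ x
  ~-sym x y x~y = trans (~ᵇ-sym y x) x~y

  Within2-graph : (∀ x y → Within2 _~_ x y) → ∀ u v → Within2 (Adj graph) u v
  Within2-graph within2 u v with within2 (from u) (from v)
  ... | inj₁ u~v           = inj₁ u~v
  ... | inj₂ (w , u~w , w~v) =
    inj₂ (to w , trans (cong (from u ~ᵇ_) (strictlyInverseʳ w)) u~w
               , trans (cong (_~ᵇ from v) (strictlyInverseʳ w)) w~v)

  ∈N-to⁺ : ∀ {x u} → x ~ from u → u ∈ N graph (to x)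
  ∈N-to⁺ {x} {u} x~u = Adj⇒∈N graph (trans (cong (_~ᵇ from u) (strictlyInverseʳ x)) x~u)

  ∈N-to⁻ : ∀ {u y} → to y ∈ N graph u → from u ~ y
  ∈N-to⁻ {u} {y} y∈N = trans (≡.sym (cong (from u ~ᵇ_) (strictlyInverseʳ y))) (∈N⇒Adj graph y∈N)

middle : Fin 3 → Bool
middle 1F = true
middle _  = false

P₃ : Graph 3
P₃ = record
  { adj    = λ u v → middle u xor middle v
  ; sym    = λ u v → xor-comm (middle u) (middle v)
  ; irrefl = λ v → xor-same (middle v)
  }

P₃-Within2 : ∀ u v → Within2 (Adj P₃) u v
P₃-Within2 0F 0F = inj₂ (1F , refl , refl)
P₃-Within2 0F 1F = inj₁ refl
P₃-Within2 0F 2F = inj₂ (1F , refl , refl)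
P₃-Within2 1F 0F = inj₁ refl
P₃-Within2 1F 1F = inj₂ (0F , refl , refl)
P₃-Within2 1F 2F = inj₁ refl
P₃-Within2 2F 0F = inj₂ (1F , refl , refl)
P₃-Within2 2F 1F = inj₁ refl
P₃-Within2 2F 2F = inj₂ (1F , refl , refl)

P₃-⊤-packing : Is2TLP P₃ ⊤
P₃-⊤-packing 0F = s≤s z≤n
P₃-⊤-packing 1F = s≤s (s≤s z≤n)
P₃-⊤-packing 2F = s≤s z≤n

P₃-L2t : L2tEq P₃ 3
P₃-L2t = (⊤ , P₃-⊤-packing , refl) , λ B _ → ∣p∣≤n B

module TwoHubs (m : ℕ) where

  c : ℕ
  c = 4 + m

  data Vertex : Set where
    leaf      : Fin c → Vertex
    hub₁ hub₂ : Vertex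
    bridge    : Fin c → Fin c → Vertex

  attached : Fin c → Fin c → Fin c → Bool
  attached i a b = i ≡ᵇ a ∨ i ≡ᵇ b

  _~ᵇ_ : Vertex → Vertex → Bool
  leaf i     ~ᵇ leaf j       = false
  leaf i     ~ᵇ hub₁         = attached i 0F 1F
  leaf i     ~ᵇ hub₂         = attached i 2F 3F
  leaf i     ~ᵇ bridge a b   = attached i a b
  hub₁       ~ᵇ leaf j       = attached j 0F 1F
  hub₁       ~ᵇ hub₁         = false
  hub₁       ~ᵇ hub₂         = true
  hub₁       ~ᵇ bridge _ _   = true
  hub₂       ~ᵇ leaf j       = attached j 2F 3F
  hub₂       ~ᵇ hub₁         = true
  hub₂       ~ᵇ hub₂         = false
  hub₂       ~ᵇ bridge _ _   = true
  bridge a b ~ᵇ leaf j       = attached j a b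
  bridge _ _ ~ᵇ hub₁         = true
  bridge _ _ ~ᵇ hub₂         = true
  bridge a b ~ᵇ bridge a′ b′ = not (a ≡ᵇ a′ ∧ b ≡ᵇ b′)

  ~ᵇ-sym : ∀ x y → x ~ᵇ y ≡ y ~ᵇ x
  ~ᵇ-sym (leaf _)     (leaf _)       = refl
  ~ᵇ-sym (leaf _)     hub₁           = refl
  ~ᵇ-sym (leaf _)     hub₂           = refl
  ~ᵇ-sym (leaf _)     (bridge _ _)   = refl
  ~ᵇ-sym hub₁         (leaf _)       = refl
  ~ᵇ-sym hub₁         hub₁           = refl
  ~ᵇ-sym hub₁         hub₂           = refl
  ~ᵇ-sym hub₁         (bridge _ _)   = refl
  ~ᵇ-sym hub₂         (leaf _)       = refl
  ~ᵇ-sym hub₂         hub₁           = refl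
  ~ᵇ-sym hub₂         hub₂           = refl
  ~ᵇ-sym hub₂         (bridge _ _)   = refl
  ~ᵇ-sym (bridge _ _) (leaf _)       = refl
  ~ᵇ-sym (bridge _ _) hub₁           = refl
  ~ᵇ-sym (bridge _ _) hub₂           = refl
  ~ᵇ-sym (bridge a b) (bridge a′ b′) = cong₂ (λ s t → not (s ∧ t)) (≡ᵇ-sym a a′) (≡ᵇ-sym b b′)

  ~ᵇ-irrefl : ∀ x → x ~ᵇ x ≡ false
  ~ᵇ-irrefl (leaf _)     = refl
  ~ᵇ-irrefl hub₁         = refl
  ~ᵇ-irrefl hub₂         = refl
  ~ᵇ-irrefl (bridge a b) = cong₂ (λ s t → not (s ∧ t)) (≡ᵇ-refl a) (≡ᵇ-refl b)

  r : ℕ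
  r = 2 + c * c

  toSum : Vertex → Fin c ⊎ Fin r
  toSum (leaf i)     = inj₁ i
  toSum hub₁         = inj₂ 0F
  toSum hub₂         = inj₂ 1F
  toSum (bridge a b) = inj₂ (suc (suc (combine a b)))

  fromSum : Fin c ⊎ Fin r → Vertex
  fromSum (inj₁ i)             = leaf i
  fromSum (inj₂ 0F)            = hub₁
  fromSum (inj₂ 1F)            = hub₂
  fromSum (inj₂ (suc (suc w))) = uncurry bridge (remQuot {c} c w)

  toSum∘fromSum : ∀ s → toSum (fromSum s) ≡ s
  toSum∘fromSum (inj₁ i)             = refl
  toSum∘fromSum (inj₂ 0F)            = refl
  toSum∘fromSum (inj₂ 1F)            = refl
  toSum∘fromSum (inj₂ (suc (suc w))) = cong (λ w → inj₂ (suc (suc w))) (combine-remQuot {c} c w)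

  fromSum∘toSum : ∀ x → fromSum (toSum x) ≡ x
  fromSum∘toSum (leaf i)     = refl
  fromSum∘toSum hub₁         = refl
  fromSum∘toSum hub₂         = refl
  fromSum∘toSum (bridge a b) = cong (uncurry bridge) (remQuot-combine a b)

  Vertex↔Fin : Vertex ↔ Fin (c + r)
  Vertex↔Fin = ↔-sym (+↔⊎ {c} {r}) ↔-∘ mk↔ₛ′ toSum fromSum toSum∘fromSum fromSum∘toSum

  open FromRelation Vertex↔Fin _~ᵇ_ ~ᵇ-sym ~ᵇ-irrefl public

  attached-left : ∀ i j → attached i i j ≡ true
  attached-left i j = cong (_∨ i ≡ᵇ j) (≡ᵇ-refl i)

  attached-right : ∀ i j → attached j i j ≡ true
  attached-right i j = trans (cong (j ≡ᵇ i ∨_) (≡ᵇ-refl j)) (∨-zeroʳ (j ≡ᵇ i))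

  attached⇒ : ∀ i a b → attached i a b ≡ true → i ≡ a ⊎ i ≡ b
  attached⇒ i a b _ with i ≟ a | i ≟ b
  ... | yes i≡a | _       = inj₁ i≡a
  ... | no _    | yes i≡b = inj₂ i≡b

  leaf-Within2-bridge : ∀ i a b → Within2 _~_ (leaf i) (bridge a b)
  leaf-Within2-bridge i a b with i ≡ᵇ a in i=a
  ... | true  = inj₁ refl
  ... | false = inj₂ (bridge i i , attached-left i i , cong (λ t → not (t ∧ i ≡ᵇ b)) i=a)

  Within2-all : ∀ x y → Within2 _~_ x y
  Within2-all (leaf i)     (leaf j)     = inj₂ (bridge i j , attached-left i j , attached-right i j)
  Within2-all (leaf i)     hub₁         = inj₂ (bridge i i , attached-left i i , refl)
  Within2-all (leaf i)     hub₂         = inj₂ (bridge i i , attached-left i i , refl)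
  Within2-all (leaf i)     (bridge a b) = leaf-Within2-bridge i a b
  Within2-all hub₁         (leaf j)     = Within2-sym ~-sym (Within2-all (leaf j) hub₁)
  Within2-all hub₁         hub₁         = inj₂ (hub₂ , refl , refl)
  Within2-all hub₁         hub₂         = inj₁ refl
  Within2-all hub₁         (bridge _ _) = inj₁ refl
  Within2-all hub₂         (leaf j)     = Within2-sym ~-sym (Within2-all (leaf j) hub₂)
  Within2-all hub₂         hub₁         = inj₁ refl
  Within2-all hub₂         hub₂         = inj₂ (hub₁ , refl , refl)
  Within2-all hub₂         (bridge _ _) = inj₁ refl
  Within2-all (bridge a b) (leaf j)     = Within2-sym ~-sym (leaf-Within2-bridge j a b)
  Within2-all (bridge _ _) hub₁         = inj₁ refl
  Within2-all (bridge _ _) hub₂         = inj₁ refl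
  Within2-all (bridge _ _) (bridge _ _) = inj₂ (hub₁ , refl , refl)

  diameter : DiamEq graph 2
  diameter = diam≡2 graph (Within2-graph Within2-all) {to (leaf 0F)} {to (leaf 1F)} (λ ()) (λ ())

  -- toSum puts the leaves first (leaf i is the vertex i ↑ˡ r), so these are the
  -- leaves and the leaves 4, …, c − 1.
  leaves : Subset (c + r)
  leaves = ⊤ {c} ++ ⊥ {r}

  farLeaves : Subset (c + r)
  farLeaves = ⊥ {4} ++ ⊤ {m} ++ ⊥ {r}

  leafNeighbours : ∀ w → ∃₂ λ a b → ∀ j → w ~ leaf j → j ≡ a ⊎ j ≡ b
  leafNeighbours (leaf i)     = i , i , λ _ ()
  leafNeighbours hub₁         = 0F , 1F , λ j → attached⇒ j 0F 1F
  leafNeighbours hub₂         = 2F , 3F , λ j → attached⇒ j 2F 3F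
  leafNeighbours (bridge a b) = a , b , λ j → attached⇒ j a b

  leaves-packing : Is2TLP graph leaves
  leaves-packing u with leafNeighbours (from u)
  ... | a , b , only-a-b = ∣p∣≤2 leaf-a-or-b
    where
    leaf-a-or-b : ∀ {x} → x ∈ leaves ∩ N graph u → x ≡ to (leaf a) ⊎ x ≡ to (leaf b)
    leaf-a-or-b x∈p =
      let x∈leaves , x∈N = x∈p∩q⁻ leaves (N graph u) x∈p
          j , x≡j        = ∈⊤++⊥⇒↑ˡ {c} {r} x∈leaves
          u~j            = ∈N-to⁻ {u} {leaf j} (subst (_∈ N graph u) x≡j x∈N)
      in Sum.map (trans x≡j ∘ cong (to ∘ leaf)) (trans x≡j ∘ cong (to ∘ leaf)) (only-a-b j u~j)

  hub-or-far : ∀ z → hub₁ ~ z ⊎ hub₂ ~ z ⊎ to z ∈ farLeaves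
  hub-or-far (leaf 0F)                         = inj₁ refl
  hub-or-far (leaf 1F)                         = inj₁ refl
  hub-or-far (leaf 2F)                         = inj₂ (inj₁ refl)
  hub-or-far (leaf 3F)                         = inj₂ (inj₁ refl)
  hub-or-far (leaf (suc (suc (suc (suc k))))) = inj₂ (inj₂ (there (there (there (there (↑ˡ∈⊤++⊥ k))))))
  hub-or-far hub₁                              = inj₂ (inj₁ refl)
  hub-or-far hub₂                              = inj₁ refl
  hub-or-far (bridge _ _)                      = inj₁ refl

  hub-neighbour-or-far : ∀ u → u ∈ N graph (to hub₁) ⊎ u ∈ N graph (to hub₂) ⊎ u ∈ farLeaves
  hub-neighbour-or-far u with hub-or-far (from u)
  ... | inj₁ hub₁~u         = inj₁ (∈N-to⁺ {hub₁} hub₁~u)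
  ... | inj₂ (inj₁ hub₂~u)  = inj₂ (inj₁ (∈N-to⁺ {hub₂} hub₂~u))
  ... | inj₂ (inj₂ u∈far)   = inj₂ (inj₂ (subst (_∈ farLeaves) (strictlyInverseˡ u) u∈far))

  packing-bound : ∀ B → Is2TLP graph B → ∣ B ∣ ≤ c
  packing-bound B packing =
    subst (∣ B ∣ ≤_) (cong (4 +_) (∣⊤++⊥∣≡m m r))
          (Is2TLP⇒∣B∣≤2+2+∣R∣ graph {to hub₁} {to hub₂} hub-neighbour-or-far B packing)

  L2t : L2tEq graph c
  L2t = (leaves , leaves-packing , ∣⊤++⊥∣≡m c r) , packing-bound

mainTheorem8 : (c : ℕ) → 3 ≤ c → ∃[ n ] Σ (Graph n) (λ G → DiamEq G 2 × L2tEq G c)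
mainTheorem8 0 ()
mainTheorem8 1 (s≤s ())
mainTheorem8 2 (s≤s (s≤s ()))
mainTheorem8 3 _ = 3 , P₃ , diam≡2 P₃ P₃-Within2 {0F} {2F} (λ ()) (λ ()) , P₃-L2t
mainTheorem8 (suc (suc (suc (suc m)))) _ = _ , graph , diameter , L2t
  where open TwoHubs m
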